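{- Let $D$ be a locatable digraph of order $n$ containing a source (a vertex of in-degree $0$) or a sink (a vertex of out-degree $0$). Then $\gamma_{OL}(D)\leq n-1$.
   Context: Digraphs are finite and may contain loops (a loop contributes to both in- and out-degree); for each ordered pair $(x,y)$ there is at most one arc $xy$. $N^-(v)$ is the set of vertices $u$ such that $uv$ is an arc. An OLD set of $D$ is a set $S\subseteq V(D)$ such that every vertex has an in-neighbour in $S$ and for every two distinct vertices $u,v$, some vertex of $S$ lies in $N^-(u)\ominus N^-(v)$. $D$ is locatable if it admits an OLD set; $\gamma_{OL}(D)$ is the minimum size of an OLD set. -}

module Defs where

open import Data.Nat using (ℕ; _≤_; _∸_)
open import Data.Bool using (Bool; true; false; _xor_)
open import Data.Fin using (Fin)
open import Data.Fin.Subset using (Subset; _∈_; ∣_∣)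
open import Data.Product using (Σ; ∃; _×_)
open import Relation.Binary.PropositionalEquality using (_≡_; _≢_)

-- A digraph of order n: vertex set Fin n, arc relation given by a Boolean
-- adjacency function (arc u v = true iff uv is an arc). Loops allowed; at most
-- one arc per ordered pair automatically.
record Digraph (n : ℕ) : Set where
  field
    arc : Fin n → Fin n → Bool
open Digraph public

InNbr : ∀ {n} → Digraph n → Fin n → Fin n → Set
InNbr D u v = arc D u v ≡ true

InSymDiff : ∀ {n} → Digraph n → Fin n → Fin n → Fin n → Set
InSymDiff D w u v = (arc D w u xor arc D w v) ≡ true

IsOLD : ∀ {n} → Digraph n → Subset n → Set
IsOLD {n} D S =
  ((v : Fin n) → Σ (Fin n) λ u → u ∈ S × InNbr D u v) ×
  ((u v : Fin n) → u ≢ v → Σ (Fin n) λ w → w ∈ S × InSymDiff D w u v)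

Locatable : ∀ {n} → Digraph n → Set
Locatable {n} D = Σ (Subset n) λ S → IsOLD D S

-- γ_OL(D) ≤ k  (for a locatable D, the minimum size of an OLD set is ≤ k
-- iff some OLD set has size ≤ k)
γOL≤ : ∀ {n} → Digraph n → ℕ → Set
γOL≤ {n} D k = Σ (Subset n) λ S → IsOLD D S × ∣ S ∣ ≤ k

IsSource : ∀ {n} → Digraph n → Fin n → Set
IsSource {n} D v = (u : Fin n) → arc D u v ≡ false

IsSink : ∀ {n} → Digraph n → Fin n → Set
IsSink {n} D v = (w : Fin n) → arc D v w ≡ false

-- A source has no in-neighbour at all, so no digraph with a source is
-- locatable. A sink v is the tail of no arc, so it never dominates a vertex
-- and never lies in a symmetric difference N⁻(x) ⊖ N⁻(y); every witness an
-- OLD set provides can therefore be found in V ∖ {v}, which is OLD of size n − 1.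
module Submission where

open import Defs
open import Data.Nat using (ℕ; _≤_; _<_; _∸_)
open import Data.Nat.Properties using (suc[m]≤n⇒m≤pred[n])
open import Data.Bool using (true; false; _xor_)
open import Data.Fin using (Fin)
open import Data.Fin.Subset using (Subset; _∈_; ∣_∣; ⊤; _-_)
open import Data.Fin.Subset.Properties using (∈⊤; x∈p∧x≢y⇒x∈p-y; x∈p⇒∣p-x∣<∣p∣; ∣⊤∣≡n)
open import Data.Product using (Σ; _×_; _,_)
open import Data.Empty using (⊥-elim)
open import Data.Sum using (_⊎_; inj₁; inj₂; [_,_])
open import Relation.Nullary using (¬_)
open import Relation.Binary.PropositionalEquality using (_≡_; _≢_; refl; sym; trans; subst)

xor≡true⇒⊎ : ∀ a b → a xor b ≡ true → a ≡ true ⊎ b ≡ true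
xor≡true⇒⊎ true  _ _ = inj₁ refl
xor≡true⇒⊎ false _ p = inj₂ p

InSymDiff⇒InNbr⊎InNbr : ∀ {n} (D : Digraph n) {w u v : Fin n} →
  InSymDiff D w u v → InNbr D w u ⊎ InNbr D w v
InSymDiff⇒InNbr⊎InNbr D {w} {u} {v} = xor≡true⇒⊎ (arc D w u) (arc D w v)

IsOLD-mono-tails : ∀ {n} (D : Digraph n) {S T : Subset n} →
  (∀ {w x} → w ∈ S → InNbr D w x → w ∈ T) → IsOLD D S → IsOLD D T
IsOLD-mono-tails D {T = T} S∩tails⊆T (dom , sep) = dom′ , sep′
  where
  dom′ : ∀ x → Σ _ λ u → u ∈ T × InNbr D u x
  dom′ x with dom x
  ... | u , u∈S , ux = u , S∩tails⊆T u∈S ux , ux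
  sep′ : ∀ x y → x ≢ y → Σ _ λ w → w ∈ T × InSymDiff D w x y
  sep′ x y x≢y with sep x y x≢y
  ... | w , w∈S , w∈x⊖y =
    w , [ S∩tails⊆T w∈S , S∩tails⊆T w∈S ] (InSymDiff⇒InNbr⊎InNbr D w∈x⊖y) , w∈x⊖y

source⇒¬Locatable : ∀ {n} (D : Digraph n) {v : Fin n} → IsSource D v → ¬ Locatable D
source⇒¬Locatable D {v} source (_ , dom , _) with dom v
... | u , _ , uv with trans (sym uv) (source u)
...   | ()

sink-not-tail : ∀ {n} (D : Digraph n) {v w x : Fin n} → IsSink D v → InNbr D w x → w ≢ v
sink-not-tail D {x = x} sink wx refl with trans (sym wx) (sink x)
... | ()

∣⊤-x∣≤n∸1 : ∀ {n} (x : Fin n) → ∣ ⊤ - x ∣ ≤ n ∸ 1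
∣⊤-x∣≤n∸1 {n} x =
  suc[m]≤n⇒m≤pred[n] (subst (∣ ⊤ - x ∣ <_) (∣⊤∣≡n n) (x∈p⇒∣p-x∣<∣p∣ (∈⊤ {x = x})))

sink⇒γOL≤n∸1 : ∀ {n} (D : Digraph n) {v : Fin n} → Locatable D → IsSink D v → γOL≤ D (n ∸ 1)
sink⇒γOL≤n∸1 D {v} (_ , old) sink =
  ⊤ - v , IsOLD-mono-tails D (λ _ wx → x∈p∧x≢y⇒x∈p-y ∈⊤ (sink-not-tail D sink wx)) old , ∣⊤-x∣≤n∸1 v

corollary2p11 : (n : ℕ) (D : Digraph n) → Locatable D →
    Σ (Fin n) (λ v → IsSource D v ⊎ IsSink D v) →
    γOL≤ D (n ∸ 1)
corollary2p11 n D locatable (v , inj₁ source) = ⊥-elim (source⇒¬Locatable D source locatable)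
corollary2p11 n D locatable (v , inj₂ sink)   = sink⇒γOL≤n∸1 D locatable sink
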